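{- Let $G$ be an antimatroid on a finite ground set $S$ with $|S|=n$, with Tutte polynomial $T(G;x,y)=\sum_{i,j}b_{i,j}x^iy^j$. For $i\ge0$ let $a_{i,1}$ be the number of convex sets of size $i$ having exactly one interior point, and for $p\in S$ let $\mathcal{C}_p$ be the collection of convex sets of $G$ whose interior is exactly $\{p\}$. Then $$b_{0,1}=\sum_{i=0}^n(-1)^ia_{i,1}=\sum_{p\in\mathrm{int}(S)}\ \sum_{C\in\mathcal{C}_p}(-1)^{|C|}.$$
   Context: An antimatroid on a finite set $S$ is a family $\mathcal{F}$ of subsets of $S$ (the feasible sets) such that $\emptyset\in\mathcal{F}$, $S\in\mathcal{F}$, $\mathcal{F}$ is closed under unions, and every nonempty $F\in\mathcal{F}$ contains some $x$ with $F-x\in\mathcal{F}$. Its rank function is $r(A)=\max\{|F|:F\in\mathcal{F},F\subseteq A\}$ and its Tutte polynomial is $T(G;x,y)=\sum_{A\subseteq S}(x-1)^{r(S)-r(A)}(y-1)^{|A|-r(A)}$. A set $C\subseteq S$ is convex if $S-C\in\mathcal{F}$ (in particular $S$ is convex). The convex closure $\overline{A}$ of $A$ is the smallest convex set containing $A$. For convex $C$, $p\in C$ is extreme if $p\notin\overline{C-p}$, and $\mathrm{int}(C)$ is the set of non-extreme points of $C$; $\mathrm{int}(S)$ is the interior of the whole ground set. -}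

module Defs where

open import Data.Nat using (ℕ; zero; suc; _∸_; _⊔_; _≡ᵇ_)
open import Data.Integer as ℤ using (ℤ; +_; -_)
open import Data.Bool using (Bool; true; false; if_then_else_; _∧_; not)
open import Data.Fin using (Fin)
open import Data.Fin.Subset using (Subset; ⊥; ⊤; _∪_; _∩_; ∁; _-_; ∣_∣; ⁅_⁆; _∈_; _⊆_)
open import Data.Vec using (Vec; []; _∷_; lookup)
open import Data.List as List using (List; []; _∷_; _++_; map; filter; foldr; length)
open import Data.Vec.Properties using (≡-dec)
import Data.Bool as B
import Data.List
open import Relation.Nullary.Decidable using (⌊_⌋)
open import Data.Product using (Σ; _×_; _,_)
open import Relation.Binary.PropositionalEquality using (_≡_)

Family : ℕ → Set
Family n = Subset n → Bool

_∈F_ : ∀ {n} → Subset n → Family n → Set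
A ∈F 𝓕 = 𝓕 A ≡ true

record IsAntimatroid {n : ℕ} (𝓕 : Family n) : Set where
  field
    empty-feasible : ⊥ ∈F 𝓕
    full-feasible  : ⊤ ∈F 𝓕
    union-closed   : ∀ A B → A ∈F 𝓕 → B ∈F 𝓕 → (A ∪ B) ∈F 𝓕
    accessible     : ∀ F → F ∈F 𝓕 → (Σ (Fin n) λ x → x ∈ F) →
                     Σ (Fin n) λ x → x ∈ F × (F - x) ∈F 𝓕

subsets : ∀ n → List (Subset n)
subsets zero    = [] ∷ []
subsets (suc n) = map (true ∷_) (subsets n) ++ map (false ∷_) (subsets n)

_⊆ᵇ_ : ∀ {n} → Subset n → Subset n → Bool
[]      ⊆ᵇ []      = true
(x ∷ A) ⊆ᵇ (y ∷ B) = (if x then y else true) ∧ (A ⊆ᵇ B)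

_≡ˢ_ : ∀ {n} → Subset n → Subset n → Bool
A ≡ˢ B = ⌊ ≡-dec B._≟_ A B ⌋

sumℤ : List ℤ → ℤ
sumℤ = foldr ℤ._+_ (+ 0)

Σsub : ∀ n → (Subset n → ℤ) → ℤ
Σsub n f = sumℤ (map f (subsets n))

negOnePow : ℕ → ℤ
negOnePow zero    = + 1
negOnePow (suc k) = - negOnePow k

rank : ∀ {n} → Family n → Subset n → ℕ
rank {n} 𝓕 A = foldr _⊔_ 0 (map ∣_∣ (filter (λ F → B.T? (𝓕 F ∧ (F ⊆ᵇ A))) (subsets n)))

-- Tutte polynomial coefficients
-- coefPow a i = coefficient of x^i in (x - 1)^a, computed by repeated
-- multiplication by (x - 1).
coefPow : ℕ → ℕ → ℤ
coefPow zero    zero    = + 1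
coefPow zero    (suc i) = + 0
coefPow (suc a) zero    = - coefPow a zero
coefPow (suc a) (suc i) = coefPow a i ℤ.- coefPow a (suc i)

-- b i j = coefficient of x^i y^j in
--   T(G;x,y) = Σ_{A ⊆ S} (x-1)^{r(S)-r(A)} (y-1)^{|A|-r(A)}
tutteCoeff : ∀ {n} → Family n → ℕ → ℕ → ℤ
tutteCoeff {n} 𝓕 i j =
  Σsub n λ A → coefPow (rank 𝓕 ⊤ ∸ rank 𝓕 A) i ℤ.* coefPow (∣ A ∣ ∸ rank 𝓕 A) j

isConvex : ∀ {n} → Family n → Subset n → Bool
isConvex 𝓕 C = 𝓕 (∁ C)

-- convex closure: the intersection of all convex sets containing A
-- (the smallest convex set containing A, since convex sets are closed under
-- intersection and S is convex)
closure : ∀ {n} → Family n → Subset n → Subset n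
closure {n} 𝓕 A = foldr _∩_ ⊤ (filter (λ C → B.T? (isConvex 𝓕 C ∧ (A ⊆ᵇ C))) (subsets n))

-- interior of C: the non-extreme points, i.e. p ∈ C with p ∈ closure (C - p)
interior : ∀ {n} → Family n → Subset n → Subset n
interior 𝓕 C = C ∩ go
  where
  go = Data.Vec.tabulate λ p → lookup (closure 𝓕 (C - p)) p

a1 : ∀ {n} → Family n → ℕ → ℕ
a1 {n} 𝓕 i = length (filter (λ C → B.T? (isConvex 𝓕 C ∧ (∣ C ∣ ≡ᵇ i) ∧ (∣ interior 𝓕 C ∣ ≡ᵇ 1))) (subsets n))

Σupto : ℕ → (ℕ → ℤ) → ℤ
Σupto zero    f = f 0
Σupto (suc m) f = Σupto m f ℤ.+ f (suc m)

Σfin : ∀ n → (Fin n → ℤ) → ℤ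
Σfin n f = sumℤ (map f (Data.List.allFin n))

rhsSum : ∀ {n} → Family n → ℤ
rhsSum {n} 𝓕 = Σfin n λ p →
  if lookup (interior 𝓕 ⊤) p
  then (Σsub n λ C → if isConvex 𝓕 C ∧ (interior 𝓕 C ≡ˢ ⁅ p ⁆) then negOnePow ∣ C ∣ else + 0)
  else + 0

-- Over an antimatroid the rank of A is the size of its kernel, the union of the feasible
-- subsets of A. The sets A with kernel K are exactly those with K ⊆ A ⊆ K ∪ B(K), where
-- B(K) is the set of points x for which K ∪ {x} is infeasible. So the coefficient of x⁰y¹
-- collects, for every feasible K, (-1)^(n-|K|) times Σ_{K ⊆ A ⊆ K ∪ B(K)} [y¹](y-1)^|A∖K|
-- = [y¹] y^|B(K)∖K|, which is (-1)^(n-|K|) when |B(K)∖K| = 1 and 0 otherwise. For the convex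
-- set C = S∖K, B(K)∖K is the interior of C: a point p of C is extreme iff (S∖C) ∪ {p} is
-- feasible. Hence b₀₁ = Σ (-1)^|C| over convex C with exactly one interior point; the other
-- two expressions are this sum grouped by |C| and by the interior point, which lies in int(S).

module Submission where

open import Defs
open import Data.Nat as ℕ using (ℕ; zero; suc; _∸_; _⊔_; _≡ᵇ_; _≤_; _<_; z≤n; s≤s)
import Data.Nat.Properties as ℕP
open import Data.Integer as ℤ using (ℤ; +_; -_; _*_; _+_)
import Data.Integer.Properties as ℤP
open import Data.Bool as Bool using (Bool; true; false; if_then_else_; _∧_; not; T?)
import Data.Bool.Properties as BoolP
open import Data.Fin as Fin using (Fin; zero; suc)
open import Data.Fin.Properties using (any?)
open import Data.Fin.Subset using (Subset; ⊥; ⊤; _∪_; _∩_; _─_; ∁; _-_; ∣_∣; ⁅_⁆; _∈_; _∉_; _⊆_; ⋃; ⋂)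
open import Data.Fin.Subset.Properties
  using (drop-∷-⊆; ⊆-trans; ∈⊤; ∉⊥; p∩q⊆p; p∩q⊆q; x∈p∩q⁺; x∈p∩q⁻; p⊆p∪q; q⊆p∪q; x∈p∪q⁻; x∈p∧x∉q⇒x∈p─q;
         x∈⁅x⁆; x∈⁅y⁆⇒x≡y; ⊆⊤; x∈p∧x≢y⇒x∈p-y; x∈p⇒∣p-x∣<∣p∣; p─q⊆p; _∈?_; ⊆-refl; ⊆-reflexive; ⊆-antisym;
         p⊆q⇒∁p⊇∁q; x∉p⇒x∈∁p; p⊆q⇒∣p∣≤∣q∣; ∣p∣≤n; ∣∁p∣≡n∸∣p∣; ∣⊤∣≡n)
open import Data.Vec as Vec using ([]; _∷_; lookup; here; there)
open import Data.Vec.Properties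
  using (map-∘; map-cong; map-id; ∷-injectiveˡ; ∷-injectiveʳ; ≡-dec; []=⇒lookup; lookup⇒[]=; lookup∘tabulate)
open import Data.List as List using (List; []; _∷_; _++_; map; filter; foldr; length)
open import Data.List.Properties using (map-tabulate)
open import Data.List.Membership.Propositional using () renaming (_∈_ to _∈ₗ_)
open import Data.List.Membership.Propositional.Properties using (∈-++⁺ˡ; ∈-++⁺ʳ; ∈-map⁺)
open import Data.List.Relation.Unary.Any using (here; there)
open import Data.Product using (_×_; _,_; ∃)
open import Data.Sum using ([_,_]; inj₁; inj₂)
open import Data.Empty using (⊥-elim)
open import Function using (_∘_)
open import Relation.Nullary using (yes; no; ¬?; _×-dec_)
open import Relation.Nullary.Decidable using (⌊_⌋; isYes≗does; dec-true; dec-false; decidable-stable)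
open import Induction.WellFounded using (Acc; acc)
open import Data.Nat.Induction using (<-wellFounded)
open import Relation.Binary.PropositionalEquality
  using (_≡_; refl; sym; trans; cong; cong₂; subst; module ≡-Reasoning)
open import Algebra.Properties.CommutativeSemigroup ℤP.+-commutativeSemigroup using (interchange)

Σlist : {A : Set} → (A → ℤ) → List A → ℤ
Σlist f xs = sumℤ (map f xs)

private
  variable
    A B : Set

Σlist-cong : {f g : A → ℤ} (xs : List A) → (∀ x → f x ≡ g x) → Σlist f xs ≡ Σlist g xs
Σlist-cong []       f≗g = refl
Σlist-cong (x ∷ xs) f≗g = cong₂ _+_ (f≗g x) (Σlist-cong xs f≗g)

Σlist-zero : {f : A → ℤ} (xs : List A) → (∀ x → f x ≡ + 0) → Σlist f xs ≡ + 0
Σlist-zero []       f≗0 = refl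
Σlist-zero (x ∷ xs) f≗0 = cong₂ _+_ (f≗0 x) (Σlist-zero xs f≗0)

Σlist-++ : (f : A → ℤ) (xs ys : List A) → Σlist f (xs ++ ys) ≡ Σlist f xs + Σlist f ys
Σlist-++ f []       ys = sym (ℤP.+-identityˡ _)
Σlist-++ f (x ∷ xs) ys = trans (cong (_+_ (f x)) (Σlist-++ f xs ys)) (sym (ℤP.+-assoc (f x) _ _))

Σlist-map : (f : B → ℤ) (g : A → B) (xs : List A) → Σlist f (map g xs) ≡ Σlist (f ∘ g) xs
Σlist-map f g []       = refl
Σlist-map f g (x ∷ xs) = cong (_+_ (f (g x))) (Σlist-map f g xs)

Σlist-+ : (f g : A → ℤ) (xs : List A) → Σlist (λ x → f x + g x) xs ≡ Σlist f xs + Σlist g xs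
Σlist-+ f g []       = refl
Σlist-+ f g (x ∷ xs) = trans (cong (_+_ (f x + g x)) (Σlist-+ f g xs)) (interchange (f x) (g x) _ _)

Σlist-*ˡ : (c : ℤ) (f : A → ℤ) (xs : List A) → Σlist (λ x → c * f x) xs ≡ c * Σlist f xs
Σlist-*ˡ c f []       = sym (ℤP.*-zeroʳ c)
Σlist-*ˡ c f (x ∷ xs) = trans (cong (_+_ (c * f x)) (Σlist-*ˡ c f xs)) (sym (ℤP.*-distribˡ-+ c (f x) _))

Σlist-neg : (f : A → ℤ) (xs : List A) → Σlist (λ x → - f x) xs ≡ - Σlist f xs
Σlist-neg f []       = refl
Σlist-neg f (x ∷ xs) = trans (cong (_+_ (- f x)) (Σlist-neg f xs)) (sym (ℤP.neg-distrib-+ (f x) _))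

Σlist-comm : (h : A → B → ℤ) (xs : List A) (ys : List B) →
             Σlist (λ x → Σlist (h x) ys) xs ≡ Σlist (λ y → Σlist (λ x → h x y) xs) ys
Σlist-comm h []       ys = sym (Σlist-zero ys (λ _ → refl))
Σlist-comm h (x ∷ xs) ys = trans (cong (_+_ (Σlist (h x) ys)) (Σlist-comm h xs ys))
                                 (sym (Σlist-+ (h x) (λ y → Σlist (λ x → h x y) xs) ys))

length-filter≡Σlist : (b : A → Bool) (xs : List A) →
                      + length (filter (T? ∘ b) xs) ≡ Σlist (λ x → if b x then + 1 else + 0) xs
length-filter≡Σlist b []       = refl
length-filter≡Σlist b (x ∷ xs) with b x
... | true  = trans (ℤP.pos-+ 1 _) (cong (_+_ (+ 1)) (length-filter≡Σlist b xs))
... | false = trans (length-filter≡Σlist b xs) (sym (ℤP.+-identityˡ _))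

Σsub-split : ∀ n (f : Subset (suc n) → ℤ) →
             Σsub (suc n) f ≡ Σsub n (f ∘ (true ∷_)) + Σsub n (f ∘ (false ∷_))
Σsub-split n f = trans (Σlist-++ f (map (true ∷_) (subsets n)) (map (false ∷_) (subsets n)))
                       (cong₂ _+_ (Σlist-map f (true ∷_) (subsets n)) (Σlist-map f (false ∷_) (subsets n)))

Σsub-cong : ∀ n {f g : Subset n → ℤ} → (∀ A → f A ≡ g A) → Σsub n f ≡ Σsub n g
Σsub-cong n = Σlist-cong (subsets n)

Σsub-zero : ∀ n {f : Subset n → ℤ} → (∀ A → f A ≡ + 0) → Σsub n f ≡ + 0
Σsub-zero n = Σlist-zero (subsets n)

Σsub-∁ : ∀ n (f : Subset n → ℤ) → Σsub n f ≡ Σsub n (f ∘ ∁)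
Σsub-∁ zero    f = refl
Σsub-∁ (suc n) f = begin
  Σsub (suc n) f
    ≡⟨ Σsub-split n f ⟩
  Σsub n (f ∘ (true ∷_)) + Σsub n (f ∘ (false ∷_))
    ≡⟨ cong₂ _+_ (Σsub-∁ n (f ∘ (true ∷_))) (Σsub-∁ n (f ∘ (false ∷_))) ⟩
  Σsub n (λ A → f (true ∷ ∁ A)) + Σsub n (λ A → f (false ∷ ∁ A))
    ≡⟨ ℤP.+-comm (Σsub n (λ A → f (true ∷ ∁ A))) _ ⟩
  Σsub n (λ A → f (false ∷ ∁ A)) + Σsub n (λ A → f (true ∷ ∁ A))
    ≡⟨ Σsub-split n (f ∘ ∁) ⟨
  Σsub (suc n) (f ∘ ∁) ∎
  where open ≡-Reasoning

Σsub-unique : ∀ n (P : Subset n → Bool) (g : Subset n → ℤ) {X : Subset n} →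
              (∀ K → P K ≡ true → K ≡ X) → P X ≡ true →
              Σsub n (λ K → if P K then g K else + 0) ≡ g X
Σsub-unique zero    P g {[]} unique PX rewrite PX = ℤP.+-identityʳ _
Σsub-unique (suc n) P g {true ∷ X} unique PX =
  trans (Σsub-split n _)
        (trans (cong₂ _+_ (Σsub-unique n (P ∘ (true ∷_)) (g ∘ (true ∷_)) (λ K → ∷-injectiveʳ ∘ unique _) PX)
                          (Σsub-zero n absent))
               (ℤP.+-identityʳ _))
  where
  absent : ∀ K → (if P (false ∷ K) then g (false ∷ K) else + 0) ≡ + 0
  absent K with P (false ∷ K) in PK
  ... | true  with () ← ∷-injectiveˡ (unique _ PK)
  ... | false = refl
Σsub-unique (suc n) P g {false ∷ X} unique PX =
  trans (Σsub-split n _)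
        (trans (cong₂ _+_ (Σsub-zero n absent)
                          (Σsub-unique n (P ∘ (false ∷_)) (g ∘ (false ∷_)) (λ K → ∷-injectiveʳ ∘ unique _) PX))
               (ℤP.+-identityˡ _))
  where
  absent : ∀ K → (if P (true ∷ K) then g (true ∷ K) else + 0) ≡ + 0
  absent K with P (true ∷ K) in PK
  ... | true  with () ← ∷-injectiveˡ (unique _ PK)
  ... | false = refl

Σsub-negOnePow : ∀ m → Σsub (suc m) (negOnePow ∘ ∣_∣) ≡ + 0
Σsub-negOnePow m = begin
  Σsub (suc m) (negOnePow ∘ ∣_∣)              ≡⟨ Σsub-split m _ ⟩
  Σsub m (λ B → - negOnePow ∣ B ∣) + Σ±       ≡⟨ cong (_+ Σ±) (Σlist-neg (negOnePow ∘ ∣_∣) (subsets m)) ⟩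
  - Σ± + Σ±                                   ≡⟨ ℤP.+-inverseˡ Σ± ⟩
  + 0                                         ∎
  where
  open ≡-Reasoning
  Σ± : ℤ
  Σ± = Σsub m (negOnePow ∘ ∣_∣)

coefPow-constant : ∀ a → coefPow a 0 ≡ negOnePow a
coefPow-constant zero    = refl
coefPow-constant (suc a) = cong -_ (coefPow-constant a)

coefPow-linear-suc : ∀ a → coefPow (suc a) 1 + coefPow a 1 ≡ negOnePow a
coefPow-linear-suc a = begin
  coefPow a 0 ℤ.- coefPow a 1 + coefPow a 1    ≡⟨ ℤP.+-assoc (coefPow a 0) _ _ ⟩
  coefPow a 0 + (- coefPow a 1 + coefPow a 1)  ≡⟨ cong (_+_ (coefPow a 0)) (ℤP.+-inverseˡ (coefPow a 1)) ⟩
  coefPow a 0 + + 0                            ≡⟨ ℤP.+-identityʳ _ ⟩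
  coefPow a 0                                  ≡⟨ coefPow-constant a ⟩
  negOnePow a                                  ∎
  where open ≡-Reasoning

-- Σ_{B ⊆ [m]} (y - 1)^|B| = y^m, read off at y^1.
Σsub-coefPow-linear : ∀ m → Σsub m (λ B → coefPow ∣ B ∣ 1) ≡ (if m ≡ᵇ 1 then + 1 else + 0)
Σsub-coefPow-linear zero    = refl
Σsub-coefPow-linear (suc m) = begin
  Σsub (suc m) (λ B → coefPow ∣ B ∣ 1)
    ≡⟨ Σsub-split m _ ⟩
  Σsub m (λ B → coefPow (suc ∣ B ∣) 1) + Σsub m (λ B → coefPow ∣ B ∣ 1)
    ≡⟨ Σlist-+ (λ B → coefPow (suc ∣ B ∣) 1) (λ B → coefPow ∣ B ∣ 1) (subsets m) ⟨
  Σsub m (λ B → coefPow (suc ∣ B ∣) 1 + coefPow ∣ B ∣ 1)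
    ≡⟨ Σsub-cong m (coefPow-linear-suc ∘ ∣_∣) ⟩
  Σsub m (negOnePow ∘ ∣_∣)
    ≡⟨ alternating m ⟩
  (if suc m ≡ᵇ 1 then + 1 else + 0) ∎
  where
  open ≡-Reasoning
  alternating : ∀ m → Σsub m (negOnePow ∘ ∣_∣) ≡ (if suc m ≡ᵇ 1 then + 1 else + 0)
  alternating zero    = refl
  alternating (suc m) = Σsub-negOnePow m

⊆ᵇ⇒⊆ : ∀ {n} {A B : Subset n} → A ⊆ᵇ B ≡ true → A ⊆ B
⊆ᵇ⇒⊆ {A = true ∷ A} {true ∷ B} A⊆B here         = here
⊆ᵇ⇒⊆ {A = a ∷ A}    {b ∷ B}    A⊆B (there x∈A) =
  there (⊆ᵇ⇒⊆ (BoolP.∧-conicalʳ (if a then b else true) _ A⊆B) x∈A)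

⊆⇒⊆ᵇ : ∀ {n} {A B : Subset n} → A ⊆ B → A ⊆ᵇ B ≡ true
⊆⇒⊆ᵇ {A = []}        {[]}    A⊆B = refl
⊆⇒⊆ᵇ {A = true ∷ A}  {b ∷ B} A⊆B with A⊆B here
... | here = ⊆⇒⊆ᵇ (drop-∷-⊆ A⊆B)
⊆⇒⊆ᵇ {A = false ∷ A} {b ∷ B} A⊆B = ⊆⇒⊆ᵇ (drop-∷-⊆ A⊆B)

-- The interval [K , K ∪ D] is a copy of the power set of ∁ K ∩ D.
Σsub-interval : ∀ n (K D : Subset n) (g : ℕ → ℤ) →
  Σsub n (λ A → if K ⊆ᵇ A ∧ A ⊆ᵇ (K ∪ D) then g (∣ A ∣ ∸ ∣ K ∣) else + 0) ≡ Σsub ∣ ∁ K ∩ D ∣ (g ∘ ∣_∣)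
Σsub-interval zero    []         []         g = refl
Σsub-interval (suc n) (true ∷ K) (d ∷ D)    g =
  trans (Σsub-split n _) (trans (cong₂ _+_ (Σsub-interval n K D g) (Σsub-zero n λ _ → refl)) (ℤP.+-identityʳ _))
Σsub-interval (suc n) (false ∷ K) (false ∷ D) g =
  trans (Σsub-split n _) (trans (cong₂ _+_ (Σsub-zero n excluded) (Σsub-interval n K D g)) (ℤP.+-identityˡ _))
  where
  excluded : ∀ A → (if K ⊆ᵇ A ∧ false then g (suc ∣ A ∣ ∸ ∣ K ∣) else + 0) ≡ + 0
  excluded A = cong (λ b → if b then g (suc ∣ A ∣ ∸ ∣ K ∣) else + 0) (BoolP.∧-zeroʳ (K ⊆ᵇ A))
Σsub-interval (suc n) (false ∷ K) (true ∷ D) g =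
  trans (Σsub-split n _)
        (trans (cong₂ _+_ (trans (Σsub-cong n count-new) (Σsub-interval n K D (g ∘ suc)))
                          (Σsub-interval n K D g))
               (sym (Σsub-split ∣ ∁ K ∩ D ∣ (g ∘ ∣_∣))))
  where
  count-new : ∀ A → (if K ⊆ᵇ A ∧ A ⊆ᵇ (K ∪ D) then g (suc ∣ A ∣ ∸ ∣ K ∣) else + 0)
                  ≡ (if K ⊆ᵇ A ∧ A ⊆ᵇ (K ∪ D) then g (suc (∣ A ∣ ∸ ∣ K ∣)) else + 0)
  count-new A with K ⊆ᵇ A in K⊆A
  ... | false = refl
  ... | true  = cong (λ k → if A ⊆ᵇ (K ∪ D) then g k else + 0)
                     (ℕP.+-∸-assoc 1 (p⊆q⇒∣p∣≤∣q∣ (⊆ᵇ⇒⊆ {A = K} {A} K⊆A)))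

Σupto-cong : ∀ m {f g : ℕ → ℤ} → (∀ i → i ≤ m → f i ≡ g i) → Σupto m f ≡ Σupto m g
Σupto-cong zero    f≗g = f≗g 0 z≤n
Σupto-cong (suc m) f≗g = cong₂ _+_ (Σupto-cong m λ i i≤m → f≗g i (ℕP.m≤n⇒m≤1+n i≤m)) (f≗g (suc m) ℕP.≤-refl)

Σupto-zero : ∀ m {f : ℕ → ℤ} → (∀ i → i ≤ m → f i ≡ + 0) → Σupto m f ≡ + 0
Σupto-zero zero    f≗0 = f≗0 0 z≤n
Σupto-zero (suc m) f≗0 =
  cong₂ _+_ (Σupto-zero m λ i i≤m → f≗0 i (ℕP.m≤n⇒m≤1+n i≤m)) (f≗0 (suc m) ℕP.≤-refl)

Σupto-comm : ∀ m (h : ℕ → A → ℤ) (xs : List A) →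
             Σupto m (λ i → Σlist (h i) xs) ≡ Σlist (λ x → Σupto m (λ i → h i x)) xs
Σupto-comm zero    h xs = refl
Σupto-comm (suc m) h xs = trans (cong (_+ Σlist (h (suc m)) xs) (Σupto-comm m h xs))
                                (sym (Σlist-+ (λ x → Σupto m (λ i → h i x)) (h (suc m)) xs))

Σupto-indicator : ∀ m {k} → k ≤ m → (v : ℕ → ℤ) → Σupto m (λ i → if k ≡ᵇ i then v i else + 0) ≡ v k
Σupto-indicator zero    z≤n v = refl
-- does (m ℕ.≟ n) reduces to m ≡ᵇ n, so dec-true/dec-false evaluate the guards.
Σupto-indicator (suc m) {k} k≤1+m v with k ℕ.≟ suc m
... | yes refl = trans (cong₂ _+_ (Σupto-zero m λ i i≤m → cong (λ b → if b then v i else + 0)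
                                      (dec-false (suc m ℕ.≟ i) (ℕP.<⇒≢ (s≤s i≤m) ∘ sym)))
                                  (cong (λ b → if b then v (suc m) else + 0) (dec-true (suc m ℕ.≟ suc m) refl)))
                       (ℤP.+-identityˡ _)
... | no k≢1+m = trans (cong₂ _+_ (Σupto-indicator m (ℕP.≤-pred (ℕP.≤∧≢⇒< k≤1+m k≢1+m)) v)
                                  (cong (λ b → if b then v (suc m) else + 0) (dec-false (k ℕ.≟ suc m) k≢1+m)))
                       (ℤP.+-identityʳ _)

Σfin-suc : ∀ n (f : Fin (suc n) → ℤ) → Σfin (suc n) f ≡ f zero + Σfin n (f ∘ suc)
Σfin-suc n f = cong (λ s → f zero + sumℤ s)
                    (trans (map-tabulate suc f) (sym (map-tabulate (λ p → p) (f ∘ suc))))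

≡ˢ-∷ : ∀ {n} a b (A B : Subset n) → ((a ∷ A) ≡ˢ (b ∷ B)) ≡ (⌊ a Bool.≟ b ⌋ ∧ (A ≡ˢ B))
≡ˢ-∷ a b A B = trans (isYes≗does (≡-dec Bool._≟_ (a ∷ A) (b ∷ B)))
                     (sym (cong₂ _∧_ (isYes≗does (a Bool.≟ b)) (isYes≗does (≡-dec Bool._≟_ A B))))

≡ˢ⊥ : ∀ {n} (X : Subset n) → (X ≡ˢ ⊥) ≡ (∣ X ∣ ≡ᵇ 0)
≡ˢ⊥ []          = refl
≡ˢ⊥ (true ∷ X)  = ≡ˢ-∷ true false X ⊥
≡ˢ⊥ (false ∷ X) = trans (≡ˢ-∷ false false X ⊥) (≡ˢ⊥ X)

Σfin-singleton : ∀ n (X : Subset n) (v : ℤ) →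
                 Σfin n (λ p → if X ≡ˢ ⁅ p ⁆ then v else + 0) ≡ (if ∣ X ∣ ≡ᵇ 1 then v else + 0)
Σfin-singleton zero    []          v = refl
Σfin-singleton (suc n) (true ∷ X)  v = begin
  Σfin (suc n) (λ p → if (true ∷ X) ≡ˢ ⁅ p ⁆ then v else + 0)
    ≡⟨ Σfin-suc n (λ p → if (true ∷ X) ≡ˢ ⁅ p ⁆ then v else + 0) ⟩
  (if (true ∷ X) ≡ˢ ⁅ zero ⁆ then v else + 0) + Σfin n (λ p → if (true ∷ X) ≡ˢ ⁅ suc p ⁆ then v else + 0)
    ≡⟨ cong₂ _+_ (cong (λ b → if b then v else + 0) (trans (≡ˢ-∷ true true X ⊥) (≡ˢ⊥ X)))
                 (Σlist-zero (List.allFin n) λ p → cong (λ b → if b then v else + 0) (≡ˢ-∷ true false X ⁅ p ⁆)) ⟩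
  (if ∣ X ∣ ≡ᵇ 0 then v else + 0) + + 0
    ≡⟨ ℤP.+-identityʳ _ ⟩
  (if ∣ X ∣ ≡ᵇ 0 then v else + 0) ∎
  where open ≡-Reasoning
Σfin-singleton (suc n) (false ∷ X) v = begin
  Σfin (suc n) (λ p → if (false ∷ X) ≡ˢ ⁅ p ⁆ then v else + 0)
    ≡⟨ Σfin-suc n (λ p → if (false ∷ X) ≡ˢ ⁅ p ⁆ then v else + 0) ⟩
  (if (false ∷ X) ≡ˢ ⁅ zero ⁆ then v else + 0) + Σfin n (λ p → if (false ∷ X) ≡ˢ ⁅ suc p ⁆ then v else + 0)
    ≡⟨ cong₂ _+_ (cong (λ b → if b then v else + 0) (≡ˢ-∷ false true X ⊥))
                 (Σlist-cong (List.allFin n) λ p → cong (λ b → if b then v else + 0) (≡ˢ-∷ false false X ⁅ p ⁆)) ⟩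
  + 0 + Σfin n (λ p → if X ≡ˢ ⁅ p ⁆ then v else + 0)
    ≡⟨ ℤP.+-identityˡ _ ⟩
  Σfin n (λ p → if X ≡ˢ ⁅ p ⁆ then v else + 0)
    ≡⟨ Σfin-singleton n X v ⟩
  (if ∣ X ∣ ≡ᵇ 1 then v else + 0) ∎
  where open ≡-Reasoning

∈-subsets : ∀ {n} (A : Subset n) → A ∈ₗ subsets n
∈-subsets []          = here refl
∈-subsets (true ∷ A)  = ∈-++⁺ˡ (∈-map⁺ (true ∷_) (∈-subsets A))
∈-subsets (false ∷ A) = ∈-++⁺ʳ (map (true ∷_) (subsets _)) (∈-map⁺ (false ∷_) (∈-subsets A))

∪-lub : ∀ {n} {p q r : Subset n} → p ⊆ r → q ⊆ r → p ∪ q ⊆ r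
∪-lub {p = p} {q} p⊆r q⊆r = [ p⊆r , q⊆r ] ∘ x∈p∪q⁻ p q

x∈p─q⇒x∉q : ∀ {n} {x : Fin n} {p q : Subset n} → x ∈ p ─ q → x ∉ q
x∈p─q⇒x∉q {p = _ ∷ p} {true ∷ q}  (there x∈p─q) (there x∈q) = x∈p─q⇒x∉q x∈p─q x∈q
x∈p─q⇒x∉q {p = _ ∷ p} {false ∷ q} (there x∈p─q) (there x∈q) = x∈p─q⇒x∉q x∈p─q x∈q

∁-involutive : ∀ {n} (p : Subset n) → ∁ (∁ p) ≡ p
∁-involutive p = trans (sym (map-∘ not not p)) (trans (map-cong BoolP.not-involutive p) (map-id p))

∁-─ : ∀ {n} (p q : Subset n) → ∁ (p ─ q) ≡ ∁ p ∪ q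
∁-─ []      []          = refl
∁-─ (s ∷ p) (true ∷ q)  = cong₂ _∷_ (sym (BoolP.∨-zeroʳ (not s))) (∁-─ p q)
∁-─ (s ∷ p) (false ∷ q) = cong₂ _∷_ (sym (BoolP.∨-identityʳ (not s))) (∁-─ p q)

≡ˢ⇒≡ : ∀ {n} {A B : Subset n} → A ≡ˢ B ≡ true → A ≡ B
≡ˢ⇒≡ {A = A} {B} A≡ˢB with ≡-dec Bool._≟_ A B
... | yes A≡B = A≡B

module _ {n : ℕ} (b : Subset n → Bool) where

  ⋂-filter-⊆ : ∀ xs {C} → C ∈ₗ xs → b C ≡ true → ⋂ (filter (T? ∘ b) xs) ⊆ C
  ⋂-filter-⊆ (x ∷ xs) C∈ bC with b x in bx
  ⋂-filter-⊆ (x ∷ xs) (here refl) bC | true  = p∩q⊆p x _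
  ⋂-filter-⊆ (x ∷ xs) (there C∈) bC  | true  = ⊆-trans (p∩q⊆q x _) (⋂-filter-⊆ xs C∈ bC)
  ⋂-filter-⊆ (x ∷ xs) (here refl) bC | false with () ← trans (sym bx) bC
  ⋂-filter-⊆ (x ∷ xs) (there C∈) bC  | false = ⋂-filter-⊆ xs C∈ bC

  ∈⋂-filter⁺ : ∀ {x} xs → (∀ {C} → C ∈ₗ xs → b C ≡ true → x ∈ C) → x ∈ ⋂ (filter (T? ∘ b) xs)
  ∈⋂-filter⁺ []       below = ∈⊤
  ∈⋂-filter⁺ (x ∷ xs) below with b x in bx
  ... | true  = x∈p∩q⁺ (below (here refl) bx , ∈⋂-filter⁺ xs (below ∘ there))
  ... | false = ∈⋂-filter⁺ xs (below ∘ there)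

  ⊆-⋃-filter : ∀ xs {C} → C ∈ₗ xs → b C ≡ true → C ⊆ ⋃ (filter (T? ∘ b) xs)
  ⊆-⋃-filter (x ∷ xs) C∈ bC with b x in bx
  ⊆-⋃-filter (x ∷ xs) (here refl) bC | true  = p⊆p∪q _
  ⊆-⋃-filter (x ∷ xs) (there C∈) bC  | true  = ⊆-trans (⊆-⋃-filter xs C∈ bC) (q⊆p∪q x _)
  ⊆-⋃-filter (x ∷ xs) (here refl) bC | false with () ← trans (sym bx) bC
  ⊆-⋃-filter (x ∷ xs) (there C∈) bC  | false = ⊆-⋃-filter xs C∈ bC

  ⋃-filter-⊆ : ∀ {X} xs → (∀ {C} → b C ≡ true → C ⊆ X) → ⋃ (filter (T? ∘ b) xs) ⊆ X
  ⋃-filter-⊆ []       above = ⊥-elim ∘ ∉⊥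
  ⋃-filter-⊆ (x ∷ xs) above with b x in bx
  ... | true  = ∪-lub (above bx) (⋃-filter-⊆ xs above)
  ... | false = ⋃-filter-⊆ xs above

  ⋃-filter-closed : (P : Subset n → Set) → P ⊥ → (∀ {A B} → P A → P B → P (A ∪ B)) →
                    (∀ {C} → b C ≡ true → P C) → ∀ xs → P (⋃ (filter (T? ∘ b) xs))
  ⋃-filter-closed P P⊥ P∪ Pb []       = P⊥
  ⋃-filter-closed P P⊥ P∪ Pb (x ∷ xs) with b x in bx
  ... | true  = P∪ (Pb bx) (⋃-filter-closed P P⊥ P∪ Pb xs)
  ... | false = ⋃-filter-closed P P⊥ P∪ Pb xs

  max-filter-≤ : ∀ {m} xs → (∀ {C} → b C ≡ true → ∣ C ∣ ≤ m) →
                 foldr _⊔_ 0 (map ∣_∣ (filter (T? ∘ b) xs)) ≤ m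
  max-filter-≤ []       bound = z≤n
  max-filter-≤ (x ∷ xs) bound with b x in bx
  ... | true  = ℕP.⊔-lub (bound bx) (max-filter-≤ xs bound)
  ... | false = max-filter-≤ xs bound

  ≤-max-filter : ∀ xs {C} → C ∈ₗ xs → b C ≡ true → ∣ C ∣ ≤ foldr _⊔_ 0 (map ∣_∣ (filter (T? ∘ b) xs))
  ≤-max-filter (x ∷ xs) C∈ bC with b x in bx
  ≤-max-filter (x ∷ xs) (here refl) bC | true  = ℕP.m≤m⊔n ∣ x ∣ _
  ≤-max-filter (x ∷ xs) (there C∈) bC  | true  = ℕP.m≤n⇒m≤o⊔n ∣ x ∣ (≤-max-filter xs C∈ bC)
  ≤-max-filter (x ∷ xs) (here refl) bC | false with () ← trans (sym bx) bC
  ≤-max-filter (x ∷ xs) (there C∈) bC  | false = ≤-max-filter xs C∈ bC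

module Convexity {n : ℕ} (𝓕 : Family n) where

  Convex : Subset n → Set
  Convex C = isConvex 𝓕 C ≡ true

  closure-least : ∀ {A C} → Convex C → A ⊆ C → closure 𝓕 A ⊆ C
  closure-least {A} {C} convex A⊆C =
    ⋂-filter-⊆ (λ D → isConvex 𝓕 D ∧ (A ⊆ᵇ D)) (subsets n) (∈-subsets C)
               (trans (cong (_∧ (A ⊆ᵇ C)) convex) (⊆⇒⊆ᵇ A⊆C))

  ∈closure⁺ : ∀ {A x} → (∀ {C} → Convex C → A ⊆ C → x ∈ C) → x ∈ closure 𝓕 A
  ∈closure⁺ {A} below = ∈⋂-filter⁺ (λ D → isConvex 𝓕 D ∧ (A ⊆ᵇ D)) (subsets n) λ {C} _ b →
    below (BoolP.∧-conicalˡ (isConvex 𝓕 C) _ b) (⊆ᵇ⇒⊆ (BoolP.∧-conicalʳ (isConvex 𝓕 C) _ b))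

  closure-mono : ∀ {A B} → A ⊆ B → closure 𝓕 A ⊆ closure 𝓕 B
  closure-mono A⊆B x∈clA = ∈closure⁺ λ convex B⊆C → closure-least convex (⊆-trans A⊆B B⊆C) x∈clA

  ∈interior⁻ : ∀ {C x} → x ∈ interior 𝓕 C → x ∈ C × x ∈ closure 𝓕 (C - x)
  ∈interior⁻ {C} {x} x∈int with x∈p∩q⁻ C _ x∈int
  ... | x∈C , non-extreme =
    x∈C , lookup⇒[]= x _ (trans (sym (lookup∘tabulate (λ p → lookup (closure 𝓕 (C - p)) p) x))
                                ([]=⇒lookup non-extreme))

  ∈interior⁺ : ∀ {C x} → x ∈ C → x ∈ closure 𝓕 (C - x) → x ∈ interior 𝓕 C
  ∈interior⁺ {C} {x} x∈C x∈cl =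
    x∈p∩q⁺ (x∈C , lookup⇒[]= x _ (trans (lookup∘tabulate (λ p → lookup (closure 𝓕 (C - p)) p) x)
                                         ([]=⇒lookup x∈cl)))

  interior-⊆-interior-⊤ : ∀ {C} → interior 𝓕 C ⊆ interior 𝓕 ⊤
  interior-⊆-interior-⊤ {C} {x} x∈int with ∈interior⁻ x∈int
  ... | _ , x∈cl = ∈interior⁺ ∈⊤ (closure-mono {C - x} {⊤ - x} C-x⊆⊤-x x∈cl)
    where
    C-x⊆⊤-x : C - x ⊆ ⊤ - x
    C-x⊆⊤-x y∈C-x = x∈p∧x∉q⇒x∈p─q ∈⊤ (x∈p─q⇒x∉q y∈C-x)

  blocked : Subset n → Subset n
  blocked K = Vec.tabulate λ x → not (𝓕 (K ∪ ⁅ x ⁆))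

  ∈blocked⁻ : ∀ K {x} → x ∈ blocked K → 𝓕 (K ∪ ⁅ x ⁆) ≡ false
  ∈blocked⁻ K {x} x∈ = trans (sym (BoolP.not-involutive _))
                             (cong not (trans (sym (lookup∘tabulate _ x)) ([]=⇒lookup x∈)))

  ∈blocked⁺ : ∀ K {x} → 𝓕 (K ∪ ⁅ x ⁆) ≡ false → x ∈ blocked K
  ∈blocked⁺ K {x} infeasible = lookup⇒[]= x _ (trans (lookup∘tabulate _ x) (cong not infeasible))

  oneInteriorTerm : Subset n → ℤ
  oneInteriorTerm C = if isConvex 𝓕 C ∧ (∣ interior 𝓕 C ∣ ≡ᵇ 1) then negOnePow ∣ C ∣ else + 0

  Σupto-a1 : Σupto n (λ i → negOnePow i * + a1 𝓕 i) ≡ Σsub n oneInteriorTerm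
  Σupto-a1 = begin
    Σupto n (λ i → negOnePow i * + a1 𝓕 i)
      ≡⟨ Σupto-cong n (λ i _ → trans (cong (negOnePow i *_) (length-filter≡Σlist (counted i) (subsets n)))
                                     (sym (Σlist-*ˡ (negOnePow i) (indicator i) (subsets n)))) ⟩
    Σupto n (λ i → Σsub n (λ C → negOnePow i * indicator i C))
      ≡⟨ Σupto-comm n (λ i C → negOnePow i * indicator i C) (subsets n) ⟩
    Σsub n (λ C → Σupto n (λ i → negOnePow i * indicator i C))
      ≡⟨ Σsub-cong n (λ C → trans (Σupto-cong n λ i _ → regroup (isConvex 𝓕 C) (∣ C ∣ ≡ᵇ i) _ (negOnePow i))
                                  (Σupto-indicator n (∣p∣≤n C) (λ i → if isConvex 𝓕 C ∧ (∣ interior 𝓕 C ∣ ≡ᵇ 1)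
                                                                       then negOnePow i else + 0))) ⟩
    Σsub n oneInteriorTerm ∎
    where
    open ≡-Reasoning
    counted : ℕ → Subset n → Bool
    counted i C = isConvex 𝓕 C ∧ (∣ C ∣ ≡ᵇ i) ∧ (∣ interior 𝓕 C ∣ ≡ᵇ 1)
    indicator : ℕ → Subset n → ℤ
    indicator i C = if counted i C then + 1 else + 0
    regroup : ∀ a e c (v : ℤ) →
              v * (if a ∧ e ∧ c then + 1 else + 0) ≡ (if e then (if a ∧ c then v else + 0) else + 0)
    regroup false e     c     v = trans (ℤP.*-zeroʳ v) (sym (BoolP.if-eta e))
    regroup true  false c     v = ℤP.*-zeroʳ v
    regroup true  true  true  v = ℤP.*-identityʳ v
    regroup true  true  false v = ℤP.*-zeroʳ v

  rhsSum≡Σsub : rhsSum 𝓕 ≡ Σsub n oneInteriorTerm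
  rhsSum≡Σsub = begin
    rhsSum 𝓕
      ≡⟨ Σlist-cong (List.allFin n) only-interior-points ⟩
    Σfin n (λ p → Σsub n (λ C → term C p))
      ≡⟨ Σlist-comm (λ p C → term C p) (List.allFin n) (subsets n) ⟩
    Σsub n (λ C → Σfin n (term C))
      ≡⟨ Σsub-cong n count-singletons ⟩
    Σsub n oneInteriorTerm ∎
    where
    open ≡-Reasoning
    term : Subset n → Fin n → ℤ
    term C p = if isConvex 𝓕 C ∧ (interior 𝓕 C ≡ˢ ⁅ p ⁆) then negOnePow ∣ C ∣ else + 0

    only-interior-points : ∀ p → (if lookup (interior 𝓕 ⊤) p then Σsub n (λ C → term C p) else + 0)
                               ≡ Σsub n (λ C → term C p)
    only-interior-points p with lookup (interior 𝓕 ⊤) p in p∉int⊤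
    ... | true  = refl
    ... | false = sym (Σsub-zero n vanishes)
      where
      vanishes : ∀ C → term C p ≡ + 0
      vanishes C with interior 𝓕 C ≡ˢ ⁅ p ⁆ in int≡⁅p⁆
      ... | false = cong (λ b → if b then negOnePow ∣ C ∣ else + 0) (BoolP.∧-zeroʳ (isConvex 𝓕 C))
      ... | true  with p∈intC ← subst (p ∈_) (sym (≡ˢ⇒≡ int≡⁅p⁆)) (x∈⁅x⁆ p)
                  with () ← trans (sym p∉int⊤) ([]=⇒lookup (interior-⊆-interior-⊤ p∈intC))

    count-singletons : ∀ C → Σfin n (term C) ≡ oneInteriorTerm C
    count-singletons C with isConvex 𝓕 C
    ... | true  = Σfin-singleton n (interior 𝓕 C) (negOnePow ∣ C ∣)
    ... | false = Σlist-zero (List.allFin n) λ _ → refl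

⁅x⁆⊆p : ∀ {n} {x : Fin n} {p : Subset n} → x ∈ p → ⁅ x ⁆ ⊆ p
⁅x⁆⊆p {x = x} {p} x∈p y∈⁅x⁆ = subst (_∈ p) (sym (x∈⁅y⁆⇒x≡y x y∈⁅x⁆)) x∈p

p-x⊆q⇒p⊆q∪⁅x⁆ : ∀ {n} {x : Fin n} {p q : Subset n} → p - x ⊆ q → p ⊆ q ∪ ⁅ x ⁆
p-x⊆q⇒p⊆q∪⁅x⁆ {x = x} {p} {q} p-x⊆q {y} y∈p with y Fin.≟ x
... | yes refl = q⊆p∪q q ⁅ x ⁆ (x∈⁅x⁆ x)
... | no  y≢x  = p⊆p∪q ⁅ x ⁆ (p-x⊆q (x∈p∧x≢y⇒x∈p-y y∈p y≢x))

module Antimatroid {n : ℕ} {𝓕 : Family n} (AM : IsAntimatroid 𝓕) where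
  open IsAntimatroid AM
  open Convexity 𝓕

  interior-of-convex : ∀ {C} → Convex C → interior 𝓕 C ≡ C ∩ blocked (∁ C)
  interior-of-convex {C} convex = ⊆-antisym interior⊆ ⊆interior
    where
    interior⊆ : interior 𝓕 C ⊆ C ∩ blocked (∁ C)
    interior⊆ {x} x∈int with ∈interior⁻ x∈int
    ... | x∈C , x∈cl = x∈p∩q⁺ (x∈C , ∈blocked⁺ (∁ C) extreme-fails)
      where
      extreme-fails : 𝓕 (∁ C ∪ ⁅ x ⁆) ≡ false
      extreme-fails with 𝓕 (∁ C ∪ ⁅ x ⁆) in feasible
      ... | false = refl
      ... | true  = ⊥-elim (x∈p─q⇒x∉q (closure-least (trans (cong 𝓕 (∁-─ C ⁅ x ⁆)) feasible) ⊆-refl x∈cl)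
                                       (x∈⁅x⁆ x))

    ⊆interior : C ∩ blocked (∁ C) ⊆ interior 𝓕 C
    ⊆interior {x} x∈ with x∈p∩q⁻ C _ x∈
    ... | x∈C , x∈blocked = ∈interior⁺ x∈C (∈closure⁺ in-every-convex)
      where
      ∁D∪∁C≡∁C∪⁅x⁆ : ∀ {D} → C - x ⊆ D → x ∉ D → ∁ D ∪ ∁ C ≡ ∁ C ∪ ⁅ x ⁆
      ∁D∪∁C≡∁C∪⁅x⁆ {D} C-x⊆D x∉D = ⊆-antisym
        (∪-lub (⊆-trans (p⊆q⇒∁p⊇∁q C-x⊆D) (⊆-reflexive (∁-─ C ⁅ x ⁆))) (p⊆p∪q ⁅ x ⁆))
        (∪-lub (q⊆p∪q (∁ D) (∁ C)) (⊆-trans (⁅x⁆⊆p (x∉p⇒x∈∁p x∉D)) (p⊆p∪q (∁ C))))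

      in-every-convex : ∀ {D} → Convex D → C - x ⊆ D → x ∈ D
      in-every-convex {D} convexD C-x⊆D with x ∈? D
      ... | yes x∈D = x∈D
      ... | no  x∉D with () ← trans (sym (∈blocked⁻ (∁ C) x∈blocked))
                                   (trans (cong 𝓕 (sym (∁D∪∁C≡∁C∪⁅x⁆ C-x⊆D x∉D)))
                                          (union-closed (∁ D) (∁ C) convexD convex))

  feasibleIn : Subset n → Subset n → Bool
  feasibleIn A F = 𝓕 F ∧ (F ⊆ᵇ A)

  kernel : Subset n → Subset n
  kernel A = ⋃ (filter (T? ∘ feasibleIn A) (subsets n))

  kernel-feasible : ∀ A → 𝓕 (kernel A) ≡ true
  kernel-feasible A = ⋃-filter-closed (feasibleIn A) (λ F → 𝓕 F ≡ true) empty-feasible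
    (λ {F} {G} → union-closed F G) (λ {F} → BoolP.∧-conicalˡ (𝓕 F) _) (subsets n)

  kernel-⊆ : ∀ A → kernel A ⊆ A
  kernel-⊆ A = ⋃-filter-⊆ (feasibleIn A) (subsets n) λ {F} F∈ → ⊆ᵇ⇒⊆ (BoolP.∧-conicalʳ (𝓕 F) _ F∈)

  kernel-maximal : ∀ {A F} → 𝓕 F ≡ true → F ⊆ A → F ⊆ kernel A
  kernel-maximal {A} {F} feasible F⊆A = ⊆-⋃-filter (feasibleIn A) (subsets n) (∈-subsets F)
    (cong₂ _∧_ feasible (⊆⇒⊆ᵇ F⊆A))

  rank≡∣kernel∣ : ∀ A → rank 𝓕 A ≡ ∣ kernel A ∣
  rank≡∣kernel∣ A = ℕP.≤-antisym
    (max-filter-≤ (feasibleIn A) (subsets n) λ {F} F∈ →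
      p⊆q⇒∣p∣≤∣q∣ (kernel-maximal (BoolP.∧-conicalˡ (𝓕 F) _ F∈) (⊆ᵇ⇒⊆ (BoolP.∧-conicalʳ (𝓕 F) _ F∈))))
    (≤-max-filter (feasibleIn A) (subsets n) (∈-subsets (kernel A))
      (cong₂ _∧_ (kernel-feasible A) (⊆⇒⊆ᵇ (kernel-⊆ A))))

  rank-⊤ : rank 𝓕 ⊤ ≡ n
  rank-⊤ = begin
    rank 𝓕 ⊤          ≡⟨ rank≡∣kernel∣ ⊤ ⟩
    ∣ kernel ⊤ ∣      ≡⟨ cong ∣_∣ (⊆-antisym ⊆⊤ (kernel-maximal full-feasible ⊆-refl)) ⟩
    ∣ ⊤ {n} ∣         ≡⟨ ∣⊤∣≡n n ⟩
    n                 ∎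
    where open ≡-Reasoning

  -- Peel L down by accessibility until the last removed point is the only one missing from K;
  -- then K ∪ ⁅ z ⁆ = K ∪ L, feasible by union-closure.
  augment : ∀ {K L x} → 𝓕 K ≡ true → 𝓕 L ≡ true → x ∈ L → x ∉ K →
            ∃ λ z → z ∈ L × z ∉ K × 𝓕 (K ∪ ⁅ z ⁆) ≡ true
  augment {K} {L} feasibleK feasibleL = go L (<-wellFounded ∣ L ∣) feasibleL
    where
    go : ∀ L → Acc _<_ ∣ L ∣ → 𝓕 L ≡ true → ∀ {x} → x ∈ L → x ∉ K →
         ∃ λ z → z ∈ L × z ∉ K × 𝓕 (K ∪ ⁅ z ⁆) ≡ true
    go L (acc smaller) feasibleL {x} x∈L x∉K with accessible L feasibleL (x , x∈L)
    ... | z , z∈L , feasibleL-z with any? (λ y → y ∈? L - z ×-dec ¬? (y ∈? K))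
    ...   | yes (y , y∈L-z , y∉K) =
      let w , w∈L-z , w∉K , feasibleK∪w = go (L - z) (smaller (x∈p⇒∣p-x∣<∣p∣ z∈L)) feasibleL-z y∈L-z y∉K
      in  w , p─q⊆p L ⁅ z ⁆ w∈L-z , w∉K , feasibleK∪w
    ...   | no  ∄y = z , z∈L , z∉K , trans (cong 𝓕 K∪⁅z⁆≡K∪L) (union-closed K L feasibleK feasibleL)
      where
      L-z⊆K : L - z ⊆ K
      L-z⊆K {y} y∈L-z = decidable-stable (y ∈? K) λ y∉K → ∄y (y , y∈L-z , y∉K)
      L⊆K∪⁅z⁆ : L ⊆ K ∪ ⁅ z ⁆
      L⊆K∪⁅z⁆ = p-x⊆q⇒p⊆q∪⁅x⁆ L-z⊆K
      z∉K : z ∉ K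
      z∉K z∈K = x∉K ([ (λ x∈K → x∈K) , (λ x∈⁅z⁆ → subst (_∈ K) (sym (x∈⁅y⁆⇒x≡y z x∈⁅z⁆)) z∈K) ]
                     (x∈p∪q⁻ K ⁅ z ⁆ (L⊆K∪⁅z⁆ x∈L)))
      K∪⁅z⁆≡K∪L : K ∪ ⁅ z ⁆ ≡ K ∪ L
      K∪⁅z⁆≡K∪L = ⊆-antisym (∪-lub (p⊆p∪q L) (⊆-trans (⁅x⁆⊆p z∈L) (q⊆p∪q K L)))
                            (∪-lub (p⊆p∪q ⁅ z ⁆) L⊆K∪⁅z⁆)

  hasKernel : Subset n → Subset n → Bool
  hasKernel K A = 𝓕 K ∧ (K ⊆ᵇ A ∧ A ⊆ᵇ (K ∪ blocked K))

  hasKernel-kernel : ∀ A → hasKernel (kernel A) A ≡ true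
  hasKernel-kernel A = cong₂ _∧_ (kernel-feasible A) (cong₂ _∧_ (⊆⇒⊆ᵇ (kernel-⊆ A)) (⊆⇒⊆ᵇ A⊆))
    where
    A⊆ : A ⊆ kernel A ∪ blocked (kernel A)
    A⊆ {x} x∈A with 𝓕 (kernel A ∪ ⁅ x ⁆) in feasible
    ... | true  = p⊆p∪q _ (kernel-maximal feasible (∪-lub (kernel-⊆ A) (⁅x⁆⊆p x∈A)) (q⊆p∪q _ ⁅ x ⁆ (x∈⁅x⁆ x)))
    ... | false = q⊆p∪q (kernel A) _ (∈blocked⁺ (kernel A) feasible)

  hasKernel⇒≡kernel : ∀ K A → hasKernel K A ≡ true → K ≡ kernel A
  hasKernel⇒≡kernel K A hasK = ⊆-antisym (kernel-maximal feasibleK K⊆A) kernel⊆K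
    where
    feasibleK = BoolP.∧-conicalˡ (𝓕 K) _ hasK
    interval  = BoolP.∧-conicalʳ (𝓕 K) _ hasK
    K⊆A       = ⊆ᵇ⇒⊆ (BoolP.∧-conicalˡ (K ⊆ᵇ A) _ interval)
    A⊆        = ⊆ᵇ⇒⊆ {A = A} {K ∪ blocked K} (BoolP.∧-conicalʳ (K ⊆ᵇ A) _ interval)
    kernel⊆K : kernel A ⊆ K
    kernel⊆K {x} x∈ker with x ∈? K
    ... | yes x∈K = x∈K
    ... | no  x∉K with augment feasibleK (kernel-feasible A) x∈ker x∉K
    ...   | z , z∈ker , z∉K , feasibleK∪z with x∈p∪q⁻ K _ (A⊆ (kernel-⊆ A z∈ker))
    ...     | inj₁ z∈K       = ⊥-elim (z∉K z∈K)
    ...     | inj₂ z∈blocked with () ← trans (sym (∈blocked⁻ K z∈blocked)) feasibleK∪z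

  weight : Subset n → Subset n → ℤ
  weight K A = negOnePow (n ∸ ∣ K ∣) * coefPow (∣ A ∣ ∸ ∣ K ∣) 1

  tutte-0-1-summand : ∀ A → coefPow (rank 𝓕 ⊤ ∸ rank 𝓕 A) 0 * coefPow (∣ A ∣ ∸ rank 𝓕 A) 1 ≡ weight (kernel A) A
  tutte-0-1-summand A rewrite rank-⊤ | rank≡∣kernel∣ A =
    cong (_* coefPow (∣ A ∣ ∸ ∣ kernel A ∣) 1) (coefPow-constant (n ∸ ∣ kernel A ∣))

  Σsub-hasKernel : ∀ K → Σsub n (λ A → if hasKernel K A then weight K A else + 0)
                       ≡ (if 𝓕 K ∧ (∣ ∁ K ∩ blocked K ∣ ≡ᵇ 1) then negOnePow (n ∸ ∣ K ∣) else + 0)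
  Σsub-hasKernel K with 𝓕 K
  ... | false = Σsub-zero n λ _ → refl
  ... | true  = begin
    Σsub n (λ A → if K ⊆ᵇ A ∧ A ⊆ᵇ (K ∪ blocked K) then sign * coefPow (∣ A ∣ ∸ ∣ K ∣) 1 else + 0)
      ≡⟨ Σsub-interval n K (blocked K) (λ b → sign * coefPow b 1) ⟩
    Σsub m (λ B → sign * coefPow ∣ B ∣ 1)
      ≡⟨ Σlist-*ˡ sign (λ B → coefPow ∣ B ∣ 1) (subsets m) ⟩
    sign * Σsub m (λ B → coefPow ∣ B ∣ 1)
      ≡⟨ cong (sign *_) (Σsub-coefPow-linear m) ⟩
    sign * (if m ≡ᵇ 1 then + 1 else + 0)
      ≡⟨ scale (m ≡ᵇ 1) ⟩
    (if m ≡ᵇ 1 then sign else + 0) ∎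
    where
    open ≡-Reasoning
    m : ℕ
    m = ∣ ∁ K ∩ blocked K ∣
    sign : ℤ
    sign = negOnePow (n ∸ ∣ K ∣)
    scale : ∀ b → sign * (if b then + 1 else + 0) ≡ (if b then sign else + 0)
    scale true  = ℤP.*-identityʳ sign
    scale false = ℤP.*-zeroʳ sign

  tutteCoeff-0-1 : tutteCoeff 𝓕 0 1 ≡ Σsub n oneInteriorTerm
  tutteCoeff-0-1 = begin
    tutteCoeff 𝓕 0 1
      ≡⟨ Σsub-cong n tutte-0-1-summand ⟩
    Σsub n (λ A → weight (kernel A) A)
      ≡⟨ Σsub-cong n (λ A → Σsub-unique n (λ K → hasKernel K A) (λ K → weight K A)
                                          (λ K → hasKernel⇒≡kernel K A) (hasKernel-kernel A)) ⟨
    Σsub n (λ A → Σsub n (λ K → if hasKernel K A then weight K A else + 0))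
      ≡⟨ Σlist-comm (λ A K → if hasKernel K A then weight K A else + 0) (subsets n) (subsets n) ⟩
    Σsub n (λ K → Σsub n (λ A → if hasKernel K A then weight K A else + 0))
      ≡⟨ Σsub-cong n Σsub-hasKernel ⟩
    Σsub n byKernel
      ≡⟨ Σsub-∁ n byKernel ⟩
    Σsub n (byKernel ∘ ∁)
      ≡⟨ Σsub-cong n byKernel-∁ ⟩
    Σsub n oneInteriorTerm ∎
    where
    open ≡-Reasoning
    byKernel : Subset n → ℤ
    byKernel K = if 𝓕 K ∧ (∣ ∁ K ∩ blocked K ∣ ≡ᵇ 1) then negOnePow (n ∸ ∣ K ∣) else + 0
    byKernel-∁ : ∀ C → byKernel (∁ C) ≡ oneInteriorTerm C
    byKernel-∁ C with isConvex 𝓕 C in convex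
    ... | false = refl
    ... | true  = cong₂ (λ I k → if ∣ I ∣ ≡ᵇ 1 then negOnePow k else + 0)
                        (trans (cong (_∩ blocked (∁ C)) (∁-involutive C)) (sym (interior-of-convex convex)))
                        (trans (cong (n ∸_) (∣∁p∣≡n∸∣p∣ C)) (ℕP.m∸[m∸n]≡n (∣p∣≤n C)))

corollary4p5 : (n : ℕ) (𝓕 : Family n) → IsAntimatroid 𝓕 →
    (tutteCoeff 𝓕 0 1 ≡ Σupto n (λ i → negOnePow i * + a1 𝓕 i))
    × (Σupto n (λ i → negOnePow i * + a1 𝓕 i) ≡ rhsSum 𝓕)
corollary4p5 n 𝓕 AM = trans tutteCoeff-0-1 (sym Σupto-a1) , trans Σupto-a1 (sym rhsSum≡Σsub)
  where
  open Convexity 𝓕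
  open Antimatroid AM
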